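{- Let $k\ge 2$, $i\in\mathbb{N}$ and $1\le b\le k-1$. Then for every $n\in\mathbb{N}$, \[ c^{(k)}\bigl((ki)\oplus(0.b);n\bigr) = c^{(k)}(b+ki;n), \] i.e. the number of occurrences of the length-2 word $(ki\,.\,ki+b)$ in $W_n^{(k)}$ equals the number of occurrences of the digit $b+ki$ in $W_n^{(k)}$.
   Context: Words are over the alphabet $\mathbb{N}=\{0,1,2,\dots\}$; $(x.y)$ denotes the length-2 word with letters $x,y$; $n\oplus W$ adds $n$ to every letter of $W$. For $k\ge 2$, $\phi_k$ is the morphism of $\mathbb{N}^*$ defined for $i\in\mathbb{N}$, $0\le j\le k-1$ by $\phi_k(ki+j)=(ki)(ki+j+1)$ if $0\le j\le k-2$ and $\phi_k(ki+k-1)=ki+k$; $W_n^{(k)}=\phi_k^n(0)$. For a nonempty word $B$, $c^{(k)}(B;n)$ is the number of (possibly overlapping) occurrences of $B$ as a factor of $W_n^{(k)}$ (for a single digit $d$, the number of occurrences of $d$). -}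

module Defs where

open import Data.Nat using (ℕ; zero; suc; _+_; _*_; _∸_; _<?_; NonZero)
open import Data.Nat.DivMod using (_/_; _%_)
open import Data.Nat.Properties using (_≟_)
open import Data.List using (List; []; _∷_; concatMap; length; take; map)
open import Data.List.Properties using (≡-dec)
open import Relation.Nullary using (yes; no)

Word : Set
Word = List ℕ

-- The morphism φ_k on a single letter m = k*i + j (i = m / k, j = m % k):
--   φ_k(ki+j) = (ki)(ki+j+1)  if 0 ≤ j ≤ k-2
--   φ_k(ki+k-1) = ki+k        (= m+1)
φletter : (k : ℕ) → .{{_ : NonZero k}} → ℕ → Word
φletter k m with (m % k) <? (k ∸ 1)
... | yes _ = (k * (m / k)) ∷ suc m ∷ []
... | no  _ = suc m ∷ []

φ : (k : ℕ) → .{{_ : NonZero k}} → Word → Word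
φ k = concatMap (φletter k)

φ^ : (k : ℕ) → .{{_ : NonZero k}} → ℕ → Word → Word
φ^ k zero    w = w
φ^ k (suc n) w = φ k (φ^ k n w)

W : (k : ℕ) → .{{_ : NonZero k}} → ℕ → Word
W k n = φ^ k n (0 ∷ [])

-- number of positions p such that B is a prefix of the suffix starting at p
-- (possibly overlapping occurrences of B as a factor)
occ : Word → Word → ℕ
occ B []       = 0
occ B (x ∷ xs) with ≡-dec _≟_ (take (length B) (x ∷ xs)) B
... | yes _ = suc (occ B xs)
... | no  _ = occ B xs

c : (k : ℕ) → .{{_ : NonZero k}} → Word → ℕ → ℕ
c k B n = occ B (W k n)

_⊕_ : ℕ → Word → Word
n ⊕ w = map (n +_) w

{-# OPTIONS --safe #-}
-- Write t = b + ki.  Among the letters m, only m = t − 1 = (b − 1) + ki has an image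
-- φ_k(m) containing t, and that image is exactly the pair (ki)(t), because b − 1 < k − 1;
-- the other images avoid t, since their second letter m + 1 ≠ t and their first letter
-- is a multiple of k while t ≢ 0 (mod k).  Hence every W_n factors into blocks (ki)(t)
-- and single letters different from t, and in such a word the occurrences of t and of
-- the factor (ki)(t) correspond one to one.
module Submission where

open import Defs
open import Data.Nat using (ℕ; NonZero; zero; suc; _+_; _*_; _∸_; _≤_; _<_; _<?_; s≤s)
open import Data.Nat.Properties
  using (_≟_; +-comm; *-comm; +-identityʳ; <-trans; n<1+n; 0≢1+n; suc-injective)
open import Data.Nat.DivMod
  using (_/_; _%_; %-remove-+ʳ; m<n⇒m%n≡m; +-distrib-/-∣ʳ; m<n⇒m/n≡0; m*n/n≡m)
open import Data.Nat.Divisibility using (m∣m*n; n∣m⇒m%n≡0)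
open import Data.List using ([]; _∷_; _++_; take; length; concatMap)
open import Data.List.Properties using (≡-dec; ∷-injectiveˡ)
open import Function using (_∘_)
open import Relation.Nullary using (yes; no; contradiction)
open import Relation.Binary.PropositionalEquality
  using (_≡_; _≢_; refl; sym; trans; cong; cong₂; subst; module ≡-Reasoning)

open ≡-Reasoning

occ-∷-prefix : ∀ B x xs → take (length B) (x ∷ xs) ≡ B → occ B (x ∷ xs) ≡ suc (occ B xs)
occ-∷-prefix B x xs prefix with ≡-dec _≟_ (take (length B) (x ∷ xs)) B
... | yes _         = refl
... | no not-prefix = contradiction prefix not-prefix

occ-∷-¬prefix : ∀ B x xs → take (length B) (x ∷ xs) ≢ B → occ B (x ∷ xs) ≡ occ B xs
occ-∷-¬prefix B x xs not-prefix with ≡-dec _≟_ (take (length B) (x ∷ xs)) B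
... | yes prefix = contradiction prefix not-prefix
... | no _       = refl

module _ (a t : ℕ) where

  data Guarded : Word → Set where
    []    : Guarded []
    other : ∀ {x xs} → x ≢ t → Guarded xs → Guarded (x ∷ xs)
    block : ∀ {xs} → Guarded xs → Guarded (a ∷ t ∷ xs)

  Guarded-++ : ∀ {u v} → Guarded u → Guarded v → Guarded (u ++ v)
  Guarded-++ []            gv = gv
  Guarded-++ (other x≢t g) gv = other x≢t (Guarded-++ g gv)
  Guarded-++ (block g)     gv = block (Guarded-++ g gv)

  Guarded-concatMap : ∀ {A : Set} (f : A → Word) → (∀ x → Guarded (f x)) →
                      ∀ xs → Guarded (concatMap f xs)
  Guarded-concatMap f gf []       = []
  Guarded-concatMap f gf (x ∷ xs) = Guarded-++ (gf x) (Guarded-concatMap f gf xs)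

  module _ (a≢t : a ≢ t) where

    Guarded-head≢ : ∀ {y ys} → Guarded (y ∷ ys) → y ≢ t
    Guarded-head≢ (other y≢t _) = y≢t
    Guarded-head≢ (block _)     = a≢t

    Guarded⇒occ-pair≡occ : ∀ {w} → Guarded w → occ (a ∷ t ∷ []) w ≡ occ (t ∷ []) w
    Guarded⇒occ-pair≡occ [] = refl
    Guarded⇒occ-pair≡occ {x ∷ xs} (other x≢t g) = begin
      occ (a ∷ t ∷ []) (x ∷ xs) ≡⟨ occ-∷-¬prefix (a ∷ t ∷ []) x xs (no-pair g) ⟩
      occ (a ∷ t ∷ []) xs       ≡⟨ Guarded⇒occ-pair≡occ g ⟩
      occ (t ∷ []) xs           ≡⟨ occ-∷-¬prefix (t ∷ []) x xs (x≢t ∘ ∷-injectiveˡ) ⟨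
      occ (t ∷ []) (x ∷ xs)     ∎
      where
      no-pair : ∀ {ys} → Guarded ys → take 2 (x ∷ ys) ≢ a ∷ t ∷ []
      no-pair []             ()
      no-pair {_ ∷ _} g refl = Guarded-head≢ g refl
    Guarded⇒occ-pair≡occ {_ ∷ _ ∷ xs} (block g) = begin
      occ (a ∷ t ∷ []) (a ∷ t ∷ xs)   ≡⟨ occ-∷-prefix (a ∷ t ∷ []) a (t ∷ xs) refl ⟩
      suc (occ (a ∷ t ∷ []) (t ∷ xs))
        ≡⟨ cong suc (occ-∷-¬prefix (a ∷ t ∷ []) t xs (a≢t ∘ sym ∘ ∷-injectiveˡ)) ⟩
      suc (occ (a ∷ t ∷ []) xs)       ≡⟨ cong suc (Guarded⇒occ-pair≡occ g) ⟩
      suc (occ (t ∷ []) xs)           ≡⟨ occ-∷-prefix (t ∷ []) t xs refl ⟨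
      occ (t ∷ []) (t ∷ xs)           ≡⟨ occ-∷-¬prefix (t ∷ []) a (t ∷ xs) (a≢t ∘ ∷-injectiveˡ) ⟨
      occ (t ∷ []) (a ∷ t ∷ xs)       ∎

module _ (k : ℕ) .{{_ : NonZero k}} {r : ℕ} (r<k : r < k) where

  [r+k*i]%k≡r : ∀ i → (r + k * i) % k ≡ r
  [r+k*i]%k≡r i = trans (%-remove-+ʳ r (m∣m*n i)) (m<n⇒m%n≡m r<k)

  [r+k*i]/k≡i : ∀ i → (r + k * i) / k ≡ i
  [r+k*i]/k≡i i = begin
    (r + k * i) / k   ≡⟨ +-distrib-/-∣ʳ r (m∣m*n i) ⟩
    r / k + k * i / k ≡⟨ cong₂ _+_ (m<n⇒m/n≡0 r<k) (trans (cong (_/ k) (*-comm k i)) (m*n/n≡m i k)) ⟩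
    i                 ∎

k*q≢[1+r]+k*i : ∀ k .{{_ : NonZero k}} {r} → suc r < k → ∀ q i → k * q ≢ suc r + k * i
k*q≢[1+r]+k*i k {r} 1+r<k q i eq = 0≢1+n (begin
  0                     ≡⟨ n∣m⇒m%n≡0 (k * q) k (m∣m*n q) ⟨
  k * q % k             ≡⟨ cong (_% k) eq ⟩
  (suc r + k * i) % k   ≡⟨ [r+k*i]%k≡r k 1+r<k i ⟩
  suc r                 ∎)

m<n∸1⇒1+m<n : ∀ {m} n → m < n ∸ 1 → suc m < n
m<n∸1⇒1+m<n (suc n) m<n∸1 = s≤s m<n∸1

module _ (k : ℕ) .{{_ : NonZero k}} (i : ℕ) {r : ℕ} (r<k∸1 : r < k ∸ 1) where

  private
    a t : ℕ
    a = k * i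
    t = suc r + k * i

    1+r<k : suc r < k
    1+r<k = m<n∸1⇒1+m<n k r<k∸1

    r<k : r < k
    r<k = <-trans (n<1+n r) 1+r<k

  φletter-Guarded : ∀ m → Guarded a t (φletter k m)
  φletter-Guarded m with m % k <? k ∸ 1
  ... | no m%k≮k∸1 = other 1+m≢t []
    where
    1+m≢t : suc m ≢ t
    1+m≢t 1+m≡t = m%k≮k∸1 (subst (_< k ∸ 1) r≡m%k r<k∸1)
      where
      r≡m%k : r ≡ m % k
      r≡m%k = sym (trans (cong (_% k) (suc-injective 1+m≡t)) ([r+k*i]%k≡r k r<k i))
  ... | yes _ with m ≟ r + k * i
  ...   | yes refl = subst (λ q → Guarded a t (k * q ∷ t ∷ [])) (sym ([r+k*i]/k≡i k r<k i)) (block [])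
  ...   | no m≢r+k*i =
    other (k*q≢[1+r]+k*i k 1+r<k (m / k) i) (other (m≢r+k*i ∘ suc-injective) [])

  W-Guarded : ∀ n → Guarded a t (W k n)
  W-Guarded zero    = other (λ ()) []
  W-Guarded (suc n) = Guarded-concatMap a t (φletter k) φletter-Guarded (W k n)

-- The hypothesis 2 ≤ k is implied by 1 ≤ b ≤ k ∸ 1.
lemma5p6 : (k : ℕ) → .{{_ : NonZero k}} → 2 ≤ k → (i b : ℕ) → 1 ≤ b → b ≤ k ∸ 1 →
    (n : ℕ) → c k ((k * i) ⊕ (0 ∷ b ∷ [])) n ≡ c k (b + k * i ∷ []) n
lemma5p6 k _ i zero    ()  _     n
lemma5p6 k _ i (suc r) _ r<k∸1 n = begin
  c k ((k * i) ⊕ (0 ∷ suc r ∷ [])) n       ≡⟨ cong (λ B → occ B (W k n)) pair-shifted ⟩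
  occ (k * i ∷ suc r + k * i ∷ []) (W k n) ≡⟨ Guarded⇒occ-pair≡occ _ _ k*i≢t (W-Guarded k i r<k∸1 n) ⟩
  c k (suc r + k * i ∷ []) n               ∎
  where
  pair-shifted : (k * i) ⊕ (0 ∷ suc r ∷ []) ≡ k * i ∷ suc r + k * i ∷ []
  pair-shifted = cong₂ (λ x y → x ∷ y ∷ []) (+-identityʳ (k * i)) (+-comm (k * i) (suc r))
  k*i≢t : k * i ≢ suc r + k * i
  k*i≢t = k*q≢[1+r]+k*i k (m<n∸1⇒1+m<n k r<k∸1) i i
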